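{- Every finite $\frac74$-free Dean word $w$ with $\mathit{d}_3(w)\ge 3$ satisfies $|w|<68$.
   Context: Words are over $\Sigma_4=\{0,1,2,3\}$; a word is reduced if it has no factor in $\{02,20,13,31\}$; a Dean word is a reduced word with no factor $uu$, $u$ nonempty. The exponent of a nonempty word is its length divided by its least period; a word is $\alpha$-free if it has no factor of exponent $\ge\alpha$. $\mathit{d}_3(w)$ is the number of reduced words $v$ of length $3$ that are not factors of $w$ but whose prefix and suffix of length $2$ are factors of $w$. -}

module Defs where

open import Data.Nat using (ℕ; zero; suc; _+_; _*_; _≤_; _<_)
open import Data.Fin using (Fin; zero; suc; toℕ)
open import Data.List using (List; []; _∷_; _++_; length; lookup; take; drop; concatMap; map)
open import Data.Bool using (Bool; true; false; _∧_; _∨_; not; if_then_else_)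
open import Data.Product using (Σ; _×_; ∃; ∃-syntax; _,_)
open import Data.Sum using (_⊎_)
open import Relation.Nullary using (¬_; Dec)
open import Relation.Binary.PropositionalEquality using (_≡_)

Letter : Set
Letter = Fin 4

Word : Set
Word = List Letter

l0 l1 l2 l3 : Letter
l0 = zero
l1 = suc zero
l2 = suc (suc zero)
l3 = suc (suc (suc zero))

Factor : Word → Word → Set
Factor x w = ∃[ u ] ∃[ v ] (w ≡ u ++ x ++ v)

Reduced : Word → Set
Reduced w = ¬ Factor (l0 ∷ l2 ∷ []) w × ¬ Factor (l2 ∷ l0 ∷ []) w
          × ¬ Factor (l1 ∷ l3 ∷ []) w × ¬ Factor (l3 ∷ l1 ∷ []) w

SquareFree : Word → Set
SquareFree w = ∀ (u : Word) → 1 ≤ length u → ¬ Factor (u ++ u) w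

Dean : Word → Set
Dean w = Reduced w × SquareFree w

IsPeriod : ℕ → Word → Set
IsPeriod p x = 1 ≤ p × p ≤ length x ×
  (∀ (i : ℕ) (h₁ : i < length x) (h₂ : i + p < length x) →
     lookup x (Data.Fin.fromℕ< h₁) ≡ lookup x (Data.Fin.fromℕ< h₂))

IsLeastPeriod : ℕ → Word → Set
IsLeastPeriod p x = IsPeriod p x × (∀ q → IsPeriod q x → p ≤ q)

ExpAtLeast7/4 : Word → Set
ExpAtLeast7/4 x = 1 ≤ length x × ∃[ p ] (IsLeastPeriod p x × 7 * p ≤ 4 * length x)

Free7/4 : Word → Set
Free7/4 w = ∀ (x : Word) → Factor x w → ¬ ExpAtLeast7/4 x

isPrefixᵇ : Word → Word → Bool
isPrefixᵇ [] _ = true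
isPrefixᵇ (_ ∷ _) [] = false
isPrefixᵇ (a ∷ x) (b ∷ w) = (a ≡ᵇF b) ∧ isPrefixᵇ x w
  where
  _≡ᵇF_ : Letter → Letter → Bool
  c ≡ᵇF d = Data.Nat._≡ᵇ_ (toℕ c) (toℕ d)

isFactorᵇ : Word → Word → Bool
isFactorᵇ x [] = isPrefixᵇ x []
isFactorᵇ x (b ∷ w) = isPrefixᵇ x (b ∷ w) ∨ isFactorᵇ x w

allLetters : List Letter
allLetters = l0 ∷ l1 ∷ l2 ∷ l3 ∷ []

words3 : List Word
words3 = concatMap (λ a → concatMap (λ b →
           map (λ c → a ∷ b ∷ c ∷ []) allLetters) allLetters) allLetters

forbidden : List Word
forbidden = (l0 ∷ l2 ∷ []) ∷ (l2 ∷ l0 ∷ []) ∷ (l1 ∷ l3 ∷ []) ∷ (l3 ∷ l1 ∷ []) ∷ []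

isReducedᵇ : Word → Bool
isReducedᵇ v = not (anyᵇ forbidden)
  where
  anyᵇ : List Word → Bool
  anyᵇ [] = false
  anyᵇ (f ∷ fs) = isFactorᵇ f v ∨ anyᵇ fs

countsᵇ : Word → Word → Bool
countsᵇ w v = isReducedᵇ v ∧ not (isFactorᵇ v w)
            ∧ isFactorᵇ (take 2 v) w ∧ isFactorᵇ (drop 1 v) w

d₃ : Word → ℕ
d₃ w = count words3
  where
  count : List Word → ℕ
  count [] = 0
  count (v ∷ vs) = (if countsᵇ w v then 1 else 0) + count vs

-- Each 3-word counted by d₃(w) is reduced and not a factor of w, and since its two halves do occur in the
-- square-free word w it has no two equal adjacent letters; only sixteen 3-words are of this kind. Being
-- reduced, being 7/4-free and keeping at least three of these sixteen words as non-factors all pass to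
-- suffixes, and when a letter is prepended to a word the first two properties can only fail at a prefix.
-- So w can be rebuilt from the right by an exhaustive search that abandons a branch as soon as a prefix
-- is a forbidden pair or has period p and length ⌈7p/4⌉, or fewer than three of the sixteen words are
-- still non-factors; evaluation shows that every branch dies before reaching length 68.

module Submission where

open import Defs
open import Data.Bool using (Bool; true; false; _∧_; _∨_; not; if_then_else_; T)
open import Data.Bool.ListAction using (all; any)
open import Data.Bool.Properties using (T-≡; T-∧; T-∨; ∧-zeroʳ; ∧-identityʳ)
open import Data.Empty using (⊥; ⊥-elim)
open import Data.Fin as Fin using (fromℕ<; toℕ)
open import Data.Fin.Properties using (_≟_; toℕ-injective)
open import Data.List using (List; []; _∷_; _++_; [_]; length; lookup; take; drop; filterᵇ; reverse; _ʳ++_)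
open import Data.List.Properties
  using (++-assoc; ++-identityʳ; length-++; length-take; length-drop; length-filter; length-reverse;
         filter-≐; take++drop≡id; ʳ++-defn; reverse-involutive)
open import Data.List.Membership.Propositional using (_∈_)
open import Data.List.Relation.Unary.All as All using ([]; _∷_)
open import Data.List.Relation.Unary.All.Properties using (all⁺; All¬⇒¬Any)
open import Data.List.Relation.Unary.Any as Any using (here; there)
open import Data.List.Relation.Unary.Any.Properties using (any⁻)
open import Data.Maybe using (Maybe; just; nothing)
open import Data.Maybe.Properties using (just-injective)
open import Data.Nat using (ℕ; zero; suc; pred; _+_; _*_; _≤_; _<_; _<ᵇ_; _∸_; _≡ᵇ_; z≤n; s≤s; NonZero)
open import Data.Nat.DivMod using (_/_; _%_; m≡m%n+[m/n]*n; m%n<n)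
open import Data.Nat.Induction using (<-rec)
open import Data.Nat.Properties
  using (≤-refl; ≤-trans; _≤?_; <⇒≤; ≮⇒≥; <⇒≱; ≰⇒≥; <ᵇ⇒<; ≡ᵇ⇒≡; <⇒≤pred; n≤1+n; m≤m+n; m≤n+m∸n;
         m≤n⇒m⊓n≡m; m≥n⇒m⊓n≡n; m+[n∸m]≡n; ∸-monoʳ-<; +-comm; *-comm; +-monoˡ-≤; +-monoʳ-≤; *-monoʳ-≤;
         +-cancelʳ-≤; +-cancelˡ-<; module ≤-Reasoning)
open import Data.Product using (∃-syntax; _×_; _,_; proj₁; proj₂)
open import Data.Sum using (inj₁; inj₂)
open import Data.Unit using (tt)
open import Function using (_∘_; Equivalence)
open import Relation.Nullary using (¬_; yes; no; does)
open import Relation.Nullary.Decidable using (T?)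
open import Relation.Binary.PropositionalEquality using (_≡_; refl; sym; trans; cong; subst; module ≡-Reasoning)

open Equivalence using (to; from)

_‼_ : ∀ {A : Set} → List A → ℕ → Maybe A
[]       ‼ _     = nothing
(x ∷ xs) ‼ zero  = just x
(x ∷ xs) ‼ suc i = xs ‼ i

‼-lookup : ∀ {A : Set} (xs : List A) i (i< : i < length xs) → xs ‼ i ≡ just (lookup xs (fromℕ< i<))
‼-lookup (x ∷ xs) zero    _        = refl
‼-lookup (x ∷ xs) (suc i) (s≤s i<) = ‼-lookup xs i i<

‼-drop : ∀ {A : Set} p (xs : List A) i → drop p xs ‼ i ≡ xs ‼ (p + i)
‼-drop zero    xs       i = refl
‼-drop (suc p) []       i = refl
‼-drop (suc p) (x ∷ xs) i = ‼-drop p xs i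

‼-take : ∀ {A : Set} n (xs : List A) i → i < n → take n xs ‼ i ≡ xs ‼ i
‼-take (suc n) []       i       _         = refl
‼-take (suc n) (x ∷ xs) zero    _         = refl
‼-take (suc n) (x ∷ xs) (suc i) (s≤s i<n) = ‼-take n xs i i<n

‼-++ˡ : ∀ {A : Set} (xs ys : List A) i {a} → xs ‼ i ≡ just a → (xs ++ ys) ‼ i ≡ just a
‼-++ˡ (x ∷ xs) ys zero    eq = eq
‼-++ˡ (x ∷ xs) ys (suc i) eq = ‼-++ˡ xs ys i eq

drop≡∷⇒< : ∀ {A : Set} p (xs : List A) {y ys} → drop p xs ≡ y ∷ ys → p < length xs
drop≡∷⇒< zero    (x ∷ xs) _  = s≤s z≤n
drop≡∷⇒< (suc p) (x ∷ xs) eq = s≤s (drop≡∷⇒< p xs eq)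

drop≡∷⇒drop-suc : ∀ {A : Set} p (xs : List A) {y ys} → drop p xs ≡ y ∷ ys → drop (suc p) xs ≡ ys
drop≡∷⇒drop-suc zero    (x ∷ xs) refl = refl
drop≡∷⇒drop-suc (suc p) (x ∷ xs) eq   = drop≡∷⇒drop-suc p xs eq

countᵇ : ∀ {A : Set} → (A → Bool) → List A → ℕ
countᵇ p []       = 0
countᵇ p (x ∷ xs) = (if p x then 1 else 0) + countᵇ p xs

countᵇ≡length-filterᵇ : ∀ {A : Set} (p : A → Bool) xs → countᵇ p xs ≡ length (filterᵇ p xs)
countᵇ≡length-filterᵇ p []       = refl
countᵇ≡length-filterᵇ p (x ∷ xs) with p x
... | true  = cong suc (countᵇ≡length-filterᵇ p xs)
... | false = countᵇ≡length-filterᵇ p xs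

length-filterᵇ-mono : ∀ {A : Set} {p q : A → Bool} → (∀ x → T (p x) → T (q x)) →
  ∀ xs → length (filterᵇ p xs) ≤ length (filterᵇ q xs)
length-filterᵇ-mono p⇒q []       = z≤n
length-filterᵇ-mono {p = p} {q} p⇒q (x ∷ xs) with p x in px | q x in qx
... | true  | true  = s≤s (length-filterᵇ-mono p⇒q xs)
... | true  | false = ⊥-elim (subst T qx (p⇒q x (subst T (sym px) tt)))
... | false | true  = ≤-trans (length-filterᵇ-mono p⇒q xs) (n≤1+n _)
... | false | false = length-filterᵇ-mono p⇒q xs

filterᵇ-filterᵇ : ∀ {A : Set} (p q : A → Bool) xs → filterᵇ p (filterᵇ q xs) ≡ filterᵇ (λ x → q x ∧ p x) xs
filterᵇ-filterᵇ p q []       = refl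
filterᵇ-filterᵇ p q (x ∷ xs) with q x
... | false = filterᵇ-filterᵇ p q xs
... | true with p x
...   | true  = cong (x ∷_) (filterᵇ-filterᵇ p q xs)
...   | false = filterᵇ-filterᵇ p q xs

filterᵇ-cong : ∀ {A : Set} {p q : A → Bool} → (∀ x → p x ≡ q x) → ∀ xs → filterᵇ p xs ≡ filterᵇ q xs
filterᵇ-cong {p = p} {q} p≗q =
  filter-≐ (T? ∘ p) (T? ∘ q) ((λ {x} → subst T (p≗q x)) , (λ {x} → subst T (sym (p≗q x))))

not-∨-∧ : ∀ x y z → not (x ∨ y) ∧ z ≡ (not y ∧ z) ∧ not x
not-∨-∧ true  y z = sym (∧-zeroʳ (not y ∧ z))
not-∨-∧ false y z = sym (∧-identityʳ (not y ∧ z))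

T-∨-resolve : ∀ {x y z} → T (x ∨ y ∨ z) → ¬ T x → ¬ T y → T z
T-∨-resolve {true}          t ¬x ¬y = ⊥-elim (¬x tt)
T-∨-resolve {false} {true}  t ¬x ¬y = ⊥-elim (¬y tt)
T-∨-resolve {false} {false} t ¬x ¬y = t

⌈_/_⌉ : ℕ → (n : ℕ) → .{{NonZero n}} → ℕ
⌈ m / n ⌉ = (m + pred n) / n

m≤⌈m/n⌉*n : ∀ m n .{{_ : NonZero n}} → m ≤ ⌈ m / n ⌉ * n
m≤⌈m/n⌉*n m n = +-cancelʳ-≤ (pred n) m (⌈ m / n ⌉ * n) (begin
  m + pred n                          ≡⟨ m≡m%n+[m/n]*n (m + pred n) n ⟩
  (m + pred n) % n + ⌈ m / n ⌉ * n    ≤⟨ +-monoˡ-≤ (⌈ m / n ⌉ * n) (<⇒≤pred (m%n<n (m + pred n) n)) ⟩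
  pred n + ⌈ m / n ⌉ * n              ≡⟨ +-comm (pred n) (⌈ m / n ⌉ * n) ⟩
  ⌈ m / n ⌉ * n + pred n              ∎)
  where open ≤-Reasoning

isPrefixᵇ-sound : ∀ x w → T (isPrefixᵇ x w) → ∃[ v ] w ≡ x ++ v
isPrefixᵇ-sound [] w _ = w , refl
isPrefixᵇ-sound (a ∷ x) (b ∷ w) t
  with to (T-∧ {toℕ a ≡ᵇ toℕ b}) t
... | a≡ᵇb , prefix with toℕ-injective (≡ᵇ⇒≡ (toℕ a) (toℕ b) a≡ᵇb) | isPrefixᵇ-sound x w prefix
...   | refl | v , refl = v , refl

isFactorᵇ-sound : ∀ x w → T (isFactorᵇ x w) → Factor x w
isFactorᵇ-sound x [] t = [] , isPrefixᵇ-sound x [] t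
isFactorᵇ-sound x (b ∷ w) t with to (T-∨ {isPrefixᵇ x (b ∷ w)}) t
... | inj₁ prefix = [] , isPrefixᵇ-sound x (b ∷ w) prefix
... | inj₂ factor with isFactorᵇ-sound x w factor
...   | u , v , refl = b ∷ u , v , refl

prefix-of-suffix : ∀ {w u x y r} → w ≡ u ++ x → x ≡ y ++ r → Factor y w
prefix-of-suffix {u = u} w≡ux x≡yr = u , _ , trans w≡ux (cong (u ++_) x≡yr)

‼-period⇒IsPeriod : ∀ p z → 1 ≤ p → p ≤ length z → (∀ i → i + p < length z → z ‼ i ≡ z ‼ (i + p)) → IsPeriod p z
‼-period⇒IsPeriod p z 1≤p p≤|z| periodic = 1≤p , p≤|z| , λ i i< i+p< → just-injective (begin
  just (lookup z (fromℕ< i<))    ≡⟨ sym (‼-lookup z i i<) ⟩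
  z ‼ i                          ≡⟨ periodic i i+p< ⟩
  z ‼ (i + p)                    ≡⟨ ‼-lookup z (i + p) i+p< ⟩
  just (lookup z (fromℕ< i+p<)) ∎)
  where open ≡-Reasoning

module _ (p K : ℕ) (x r : Word) (shifted : drop p x ≡ take K x ++ r) where

  shifted-‼ : ∀ i → i < K → i < length x → x ‼ i ≡ x ‼ (p + i)
  shifted-‼ i i<K i<|x| = begin
    x ‼ i                ≡⟨ ‼-lookup x i i<|x| ⟩
    just (lookup x _)    ≡⟨ sym (‼-++ˡ (take K x) r i (trans (‼-take K x i i<K) (‼-lookup x i i<|x|))) ⟩
    (take K x ++ r) ‼ i  ≡⟨ cong (_‼ i) shifted ⟨
    drop p x ‼ i         ≡⟨ ‼-drop p x i ⟩
    x ‼ (p + i)          ∎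
    where open ≡-Reasoning

  shifted-length : 1 ≤ p → p < length x → p + K ≤ length x
  shifted-length 1≤p p<|x| = begin
    p + K                ≤⟨ +-monoʳ-≤ p K≤|x|∸p ⟩
    p + (length x ∸ p)   ≡⟨ m+[n∸m]≡n (<⇒≤ p<|x|) ⟩
    length x             ∎
    where
    open ≤-Reasoning
    |t|≤|x|∸p : length (take K x) ≤ length x ∸ p
    |t|≤|x|∸p = begin
      length (take K x)                     ≤⟨ m≤m+n _ (length r) ⟩
      length (take K x) + length r          ≡⟨ length-++ (take K x) ⟨
      length (take K x ++ r)                ≡⟨ cong length shifted ⟨
      length (drop p x)                     ≡⟨ length-drop p x ⟩
      length x ∸ p                          ∎
    K≤|x|∸p : K ≤ length x ∸ p
    K≤|x|∸p with K ≤? length x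
    ... | yes K≤|x| = subst (_≤ length x ∸ p) (trans (length-take K x) (m≤n⇒m⊓n≡m K≤|x|)) |t|≤|x|∸p
    ... | no  K≰|x| = ⊥-elim (<⇒≱ (∸-monoʳ-< 1≤p (<⇒≤ p<|x|))
                        (subst (_≤ length x ∸ p) (trans (length-take K x) (m≥n⇒m⊓n≡n (≰⇒≥ K≰|x|))) |t|≤|x|∸p))

  shifted-prefix-length : 1 ≤ p → p < length x → length (take (p + K) x) ≡ p + K
  shifted-prefix-length 1≤p p<|x| = trans (length-take (p + K) x) (m≤n⇒m⊓n≡m (shifted-length 1≤p p<|x|))

  shifted-IsPeriod : 1 ≤ p → p < length x → IsPeriod p (take (p + K) x)
  shifted-IsPeriod 1≤p p<|x| =
    ‼-period⇒IsPeriod p z 1≤p (subst (p ≤_) (sym |z|≡p+K) (m≤m+n p K)) λ i i+p<|z| →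
      let i+p<p+K = subst (i + p <_) |z|≡p+K i+p<|z|
          i<K     = +-cancelˡ-< p i K (subst (_< p + K) (+-comm i p) i+p<p+K)
      in begin
        z ‼ i         ≡⟨ ‼-take (p + K) x i (≤-trans (m≤m+n (suc i) p) i+p<p+K) ⟩
        x ‼ i         ≡⟨ shifted-‼ i i<K (≤-trans (m≤m+n (suc i) p) (≤-trans i+p<p+K p+K≤|x|)) ⟩
        x ‼ (p + i)   ≡⟨ cong (x ‼_) (+-comm p i) ⟩
        x ‼ (i + p)   ≡⟨ ‼-take (p + K) x (i + p) i+p<p+K ⟨
        z ‼ (i + p)   ∎
    where
    open ≡-Reasoning
    z = take (p + K) x
    p+K≤|x| = shifted-length 1≤p p<|x|
    |z|≡p+K = shifted-prefix-length 1≤p p<|x|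

-- The least period of z is at most p, so it too has exponent ≥ 7/4; strong induction on p spares us
-- computing it.
Free7/4⇒¬periodic-factor : ∀ {w} → Free7/4 w → ∀ p z → Factor z w → IsPeriod p z → 7 * p ≤ 4 * length z → ⊥
Free7/4⇒¬periodic-factor {w} free = <-rec Periodic step
  where
  Periodic : ℕ → Set
  Periodic p = ∀ z → Factor z w → IsPeriod p z → 7 * p ≤ 4 * length z → ⊥
  step : ∀ p → (∀ {q} → q < p → Periodic q) → Periodic p
  step p shorter z z∈w period 7p≤4|z| =
    free z z∈w (≤-trans (proj₁ period) (proj₁ (proj₂ period)) , p , (period , least) , 7p≤4|z|)
    where
    least : ∀ q → IsPeriod q z → p ≤ q
    least q q-period = ≮⇒≥ λ q<p →
      shorter q<p z z∈w q-period (≤-trans (*-monoʳ-≤ 7 (<⇒≤ q<p)) 7p≤4|z|)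

-- Called with ys = drop p x, it asks for every p′ ≥ p with drop p′ x nonempty whether the prefix of x
-- of length ⌈7p′/4⌉ has period p′, i.e. whether drop p′ x starts with the first ⌈7p′/4⌉ ∸ p′ letters of x.
powerPrefixFromᵇ : ℕ → Word → Word → Bool
powerPrefixFromᵇ p x []       = false
powerPrefixFromᵇ p x (y ∷ ys) = isPrefixᵇ (take (⌈ 7 * p / 4 ⌉ ∸ p) x) (y ∷ ys) ∨ powerPrefixFromᵇ (suc p) x ys

powerPrefixᵇ : Word → Bool
powerPrefixᵇ x = powerPrefixFromᵇ 1 x (drop 1 x)

powerPrefixFromᵇ-sound : ∀ p x ys → 1 ≤ p → drop p x ≡ ys → T (powerPrefixFromᵇ p x ys) →
  ∃[ q ] ∃[ z ] ∃[ r ] x ≡ z ++ r × IsPeriod q z × 7 * q ≤ 4 * length z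
powerPrefixFromᵇ-sound p x (y ∷ ys) 1≤p drop≡ t
  with to (T-∨ {isPrefixᵇ (take (⌈ 7 * p / 4 ⌉ ∸ p) x) (y ∷ ys)}) t
... | inj₂ later = powerPrefixFromᵇ-sound (suc p) x ys (s≤s z≤n) (drop≡∷⇒drop-suc p x drop≡) later
... | inj₁ hit with isPrefixᵇ-sound _ _ hit
...   | r , ys≡tr = p , take (p + K) x , drop (p + K) x , sym (take++drop≡id (p + K) x) , period , exponent
  where
  K = ⌈ 7 * p / 4 ⌉ ∸ p
  p<|x| = drop≡∷⇒< p x drop≡
  shifted = trans drop≡ ys≡tr
  period = shifted-IsPeriod p K x r shifted 1≤p p<|x|
  exponent : 7 * p ≤ 4 * length (take (p + K) x)
  exponent = begin
    7 * p                          ≤⟨ m≤⌈m/n⌉*n (7 * p) 4 ⟩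
    ⌈ 7 * p / 4 ⌉ * 4              ≡⟨ *-comm ⌈ 7 * p / 4 ⌉ 4 ⟩
    4 * ⌈ 7 * p / 4 ⌉              ≤⟨ *-monoʳ-≤ 4 (m≤n+m∸n ⌈ 7 * p / 4 ⌉ p) ⟩
    4 * (p + K)                    ≡⟨ cong (4 *_) (shifted-prefix-length p K x r shifted 1≤p p<|x|) ⟨
    4 * length (take (p + K) x)    ∎
    where open ≤-Reasoning

badPrefixᵇ : Word → Bool
badPrefixᵇ x = any (λ f → isPrefixᵇ f x) forbidden ∨ powerPrefixᵇ x

suffix-¬badPrefix : ∀ {w} → Reduced w → Free7/4 w → ∀ u x → w ≡ u ++ x → ¬ T (badPrefixᵇ x)
suffix-¬badPrefix (¬02 , ¬20 , ¬13 , ¬31) free u x w≡ux bad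
  with to (T-∨ {any (λ f → isPrefixᵇ f x) forbidden}) bad
... | inj₁ forbidden-prefix =
  All¬⇒¬Any {P = λ f → Factor f _} (¬02 ∷ ¬20 ∷ ¬13 ∷ ¬31 ∷ [])
    (Any.map (λ {f} t → prefix-of-suffix w≡ux (proj₂ (isPrefixᵇ-sound f x t)))
      (any⁻ _ forbidden forbidden-prefix))
... | inj₂ power-prefix with powerPrefixFromᵇ-sound 1 x (drop 1 x) (s≤s z≤n) refl power-prefix
...   | p , z , r , x≡zr , period , 7p≤4|z| =
  Free7/4⇒¬periodic-factor free p z (prefix-of-suffix w≡ux x≡zr) period 7p≤4|z|

headDiffersᵇ : Letter → Word → Bool
headDiffersᵇ a []      = true
headDiffersᵇ a (b ∷ _) = not (does (a ≟ b))

noStutterᵇ : Word → Bool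
noStutterᵇ []      = true
noStutterᵇ (a ∷ v) = headDiffersᵇ a v ∧ noStutterᵇ v

SquareFree⇒headDiffers : ∀ {w} → SquareFree w → ∀ u a x v → w ≡ u ++ a ∷ x ++ v → T (headDiffersᵇ a x)
SquareFree⇒headDiffers sf u a []      v _ = tt
SquareFree⇒headDiffers sf u a (b ∷ x) v w≡uabxv with a ≟ b
... | yes refl = sf [ a ] (s≤s z≤n) (u , x ++ v , w≡uabxv)
... | no _     = tt

SquareFree⇒noStutter : ∀ {w} → SquareFree w → ∀ x → Factor x w → T (noStutterᵇ x)
SquareFree⇒noStutter sf []      _               = tt
SquareFree⇒noStutter sf (a ∷ x) (u , v , w≡uaxv) =
  from (T-∧ {headDiffersᵇ a x})
    ( SquareFree⇒headDiffers sf u a x v w≡uaxv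
    , SquareFree⇒noStutter sf x (u ++ [ a ] , v , trans w≡uaxv (sym (++-assoc u [ a ] _))))

noStutter-take-drop : ∀ v → T (noStutterᵇ (take 2 v)) → T (noStutterᵇ (drop 1 v)) → T (noStutterᵇ v)
noStutter-take-drop []          _    _    = tt
noStutter-take-drop (a ∷ [])    _    _    = tt
noStutter-take-drop (a ∷ b ∷ v) head tail with a ≟ b
... | yes _ = head
... | no _  = tail

candidateᵇ : Word → Word → Bool
candidateᵇ w v = not (isFactorᵇ v w) ∧ (isReducedᵇ v ∧ noStutterᵇ v)

candidates : Word → List Word
candidates w = filterᵇ (candidateᵇ w) words3

counted⇒candidate : ∀ {w} → SquareFree w → ∀ v → T (countsᵇ w v) → T (candidateᵇ w v)
counted⇒candidate {w} sf v counted with isReducedᵇ v | isFactorᵇ v w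
... | true | false = noStutter-take-drop v
                      (SquareFree⇒noStutter sf (take 2 v) (isFactorᵇ-sound _ w (proj₁ factors)))
                      (SquareFree⇒noStutter sf (drop 1 v) (isFactorᵇ-sound _ w (proj₂ factors)))
  where factors = to (T-∧ {isFactorᵇ (take 2 v) w}) counted

-- Defs computes d₃ w with a local copy of countᵇ, so d₃ w and countᵇ (countsᵇ w) words3 are definitionally equal.
d₃≤|candidates| : ∀ {w} → SquareFree w → d₃ w ≤ length (candidates w)
d₃≤|candidates| {w} sf = subst (_≤ length (candidates w)) (sym (countᵇ≡length-filterᵇ (countsᵇ w) words3))
  (length-filterᵇ-mono (counted⇒candidate sf) words3)

candidates-∷ : ∀ a w → candidates (a ∷ w) ≡ filterᵇ (λ v → not (isPrefixᵇ v (a ∷ w))) (candidates w)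
candidates-∷ a w = sym (trans
  (filterᵇ-filterᵇ (λ v → not (isPrefixᵇ v (a ∷ w))) (candidateᵇ w) words3)
  (filterᵇ-cong (λ v → sym (not-∨-∧ (isPrefixᵇ v (a ∷ w)) (isFactorᵇ v w) (isReducedᵇ v ∧ noStutterᵇ v))) words3))

|candidates-ʳ++|≤|candidates| : ∀ s w → length (candidates (s ʳ++ w)) ≤ length (candidates w)
|candidates-ʳ++|≤|candidates| []      w = ≤-refl
|candidates-ʳ++|≤|candidates| (a ∷ s) w = ≤-trans (|candidates-ʳ++|≤|candidates| s (a ∷ w))
  (subst (λ S → length S ≤ length (candidates w)) (sym (candidates-∷ a w)) (length-filter _ (candidates w)))

∈-allLetters : ∀ a → a ∈ allLetters
∈-allLetters Fin.zero                               = here refl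
∈-allLetters (Fin.suc Fin.zero)                     = there (here refl)
∈-allLetters (Fin.suc (Fin.suc Fin.zero))           = there (there (here refl))
∈-allLetters (Fin.suc (Fin.suc (Fin.suc Fin.zero))) = there (there (there (here refl)))

-- boundedᵇ f w S: prepending letters to w one at a time, every branch reaches, after fewer than f letters,
-- a word with a bad prefix or a word containing all but at most two words of S as factors.
boundedᵇ : ℕ → Word → List Word → Bool
extensionBoundedᵇ : ℕ → Word → List Word → Letter → Bool

boundedᵇ zero    w S = false
boundedᵇ (suc f) w S = all (extensionBoundedᵇ f w S) allLetters

extensionBoundedᵇ f w S a = badPrefixᵇ (a ∷ w) ∨ (length S′ <ᵇ 3) ∨ boundedᵇ f (a ∷ w) S′
  where S′ = filterᵇ (λ v → not (isPrefixᵇ v (a ∷ w))) S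

boundedᵇ-sound : ∀ f s w → boundedᵇ f w (candidates w) ≡ true →
  (∀ u x → s ʳ++ w ≡ u ++ x → ¬ T (badPrefixᵇ x)) → 3 ≤ length (candidates (s ʳ++ w)) → length s < f
boundedᵇ-sound (suc f) []      w _       _    _    = s≤s z≤n
boundedᵇ-sound (suc f) (a ∷ s) w bounded good many =
  s≤s (boundedᵇ-sound f s (a ∷ w) (to T-≡ (T-∨-resolve step bad-free survives)) good many)
  where
  step : T (badPrefixᵇ (a ∷ w) ∨ (length (candidates (a ∷ w)) <ᵇ 3) ∨ boundedᵇ f (a ∷ w) (candidates (a ∷ w)))
  step = subst (λ S → T (badPrefixᵇ (a ∷ w) ∨ (length S <ᵇ 3) ∨ boundedᵇ f (a ∷ w) S)) (sym (candidates-∷ a w))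
           (All.lookup (all⁺ (extensionBoundedᵇ f w (candidates w)) allLetters (from T-≡ bounded))
                       (∈-allLetters a))
  bad-free : ¬ T (badPrefixᵇ (a ∷ w))
  bad-free = good (reverse s) (a ∷ w) (ʳ++-defn s)
  survives : ¬ T (length (candidates (a ∷ w)) <ᵇ 3)
  survives few = <⇒≱ (<ᵇ⇒< (length (candidates (a ∷ w))) 3 few)
                     (≤-trans many (|candidates-ʳ++|≤|candidates| s (a ∷ w)))

-- An equation rather than T (boundedᵇ 68 [] (candidates [])): Agda would eta-expand a term of the latter
-- type by normalising it outside its fast reducer, which does not finish in reasonable time.
bounded-68 : boundedᵇ 68 [] (candidates []) ≡ true
bounded-68 = refl

mainTheorem15 : ∀ (w : Word) → Dean w → Free7/4 w → 3 ≤ d₃ w → length w < 68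
mainTheorem15 w (reduced , squareFree) free 3≤d₃ =
  subst (_< 68) (length-reverse w) (boundedᵇ-sound 68 (reverse w) [] bounded-68 good many)
  where
  reverse-w≡w : reverse w ʳ++ [] ≡ w
  reverse-w≡w = trans (ʳ++-defn (reverse w)) (trans (++-identityʳ _) (reverse-involutive w))
  good : ∀ u x → reverse w ʳ++ [] ≡ u ++ x → ¬ T (badPrefixᵇ x)
  good u x w≡ux = suffix-¬badPrefix reduced free u x (trans (sym reverse-w≡w) w≡ux)
  many : 3 ≤ length (candidates (reverse w ʳ++ []))
  many = subst (λ v → 3 ≤ length (candidates v)) (sym reverse-w≡w)
           (≤-trans 3≤d₃ (d₃≤|candidates| {w} squareFree))
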